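{- Let $\mathcal{C}$ be a nowhere dense class of static graphs with denseness function $d$, let $\Lambda\in\mathbb{N}$, and let $\mathcal{C}'$ be the class of all temporal graphs with footprint in $\mathcal{C}$ and lifetime at most $\Lambda$. Then the class $\{\mathrm{Gf}(\mathcal{S}_{\Lambda}(\mathcal{G})):\mathcal{G}\in\mathcal{C}'\}$ of Gaifman graphs of lifetime encodings is nowhere dense; in particular, $g(r):=d(\lceil r/2\rceil)+2\Lambda$ is a denseness function for this class.
   Context: A temporal graph $\mathcal{G}=(V,E,\lambda)$ consists of a static graph $G=(V,E)$ (the footprint) and a labelling $\lambda$ assigning each edge a nonempty finite set of time steps in $\mathbb{N}_{\ge1}$; temporal edges are pairs $(e,t)$ with $t\in\lambda(e)$, forming the set $\mathcal{E}$; the lifetime is the largest label. The lifetime encoding $\mathcal{S}_{\Lambda}(\mathcal{G})$ is the relational structure with universe $V\cup\mathcal{E}\cup L$, where $L$ is the set of time steps $\{1,\dots,\text{lifetime}\}$, unary predicates for $V,\mathcal{E},L$, and binary relations $\mathsf{inc}((uv,t),x)$ iff $x\in\{u,v\}$; $\mathsf{pres}((uv,t),t')$ iff $t'=t$; and the strict order $<$ on $L$. The Gaifman graph $\mathrm{Gf}(\mathcal{S})$ of a relational structure $\mathcal{S}$ with universe $U$ is the simple undirected graph on $U$ in which distinct $a,b$ are adjacent iff they occur together in some tuple of some relation of arity at least 2. For graphs $H,G$ and $r\in\mathbb{N}$, $H\preceq_r G$ ($H$ is a depth-$r$ topological minor of $G$) if some graph obtained from $H$ by replacing a subset of its edges by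 pairwise internally vertex-disjoint paths of length at most $r+1$ is isomorphic to a subgraph of $G$. A graph class $\mathcal{C}$ is nowhere dense if there is a function $d:\mathbb{N}\to\mathbb{N}$, called a denseness function, such that $K_{d(r)}\not\preceq_r G$ for every $r\in\mathbb{N}$ and every $G\in\mathcal{C}$. -}

module Defs where

open import Level using (Level; _⊔_) renaming (suc to lsuc)
open import Data.Nat as ℕ using (ℕ; zero; suc; _≤_; _<_; _≡ᵇ_) renaming (_⊔_ to _⊔ℕ_)
open import Data.Fin as Fin using (Fin; zero; suc)
open import Data.Bool using (Bool; true; false; T)
open import Data.List using (List; []; _∷_; length; foldr; concatMap; allFin)
open import Data.Bool.ListAction using (any)
open import Data.List.Membership.Propositional using () renaming (_∈_ to _∈ˡ_)
open import Data.List.Relation.Unary.Unique.Propositional using (Unique)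
open import Data.List.Relation.Unary.All using (All)
open import Data.Vec using (Vec; []; _∷_)
open import Data.Vec.Membership.Propositional using () renaming (_∈_ to _∈ᵛ_)
open import Data.Product using (Σ; ∃; _×_; _,_; proj₁; proj₂)
open import Data.Sum using (_⊎_; inj₁; inj₂)
open import Data.Empty using (⊥)
open import Data.Unit using (⊤)
open import Relation.Nullary using (¬_)
open import Relation.Binary.PropositionalEquality using (_≡_; _≢_; refl; sym; subst)

record Graph : Set₁ where
  field
    V     : Set
    _~_   : V → V → Set
    ~-sym : ∀ {a b} → a ~ b → b ~ a
    ~-irr : ∀ {a} → ¬ (a ~ a)

record StaticGraph : Set where
  field
    n       : ℕ
    adj     : Fin n → Fin n → Bool
    adj-sym : ∀ u v → adj u v ≡ adj v u
    adj-irr : ∀ u → adj u u ≡ false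

toGraph : StaticGraph → Graph
toGraph G = record
  { V = Fin n
  ; _~_ = λ u v → T (adj u v)
  ; ~-sym = λ {a} {b} p → subst T (adj-sym a b) p
  ; ~-irr = λ {a} p → subst T (adj-irr a) p
  }
  where open StaticGraph G

-- Branch vertices φ i (injective); for every edge {i,j} (i < j) of K_t a
-- path φ i — w₁ — … — w_k — φ j in G with k ≤ r internal vertices
-- (so length k+1 ≤ r+1; k = 0 means the edge is kept as an edge);
-- internal vertices are distinct, avoid all branch vertices, and the
-- paths are pairwise internally vertex-disjoint.

Walk : (G : Graph) → Graph.V G → List (Graph.V G) → Graph.V G → Set
Walk G x []       y = Graph._~_ G x y
Walk G x (w ∷ ws) y = Graph._~_ G x w × Walk G w ws y

record KTopMinor (t r : ℕ) (G : Graph) : Set where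
  open Graph G
  field
    φ        : Fin t → V
    φ-inj    : ∀ i j → φ i ≡ φ j → i ≡ j
    path     : Fin t → Fin t → List V
    path-len : ∀ i j → i Fin.< j → length (path i j) ≤ r
    path-walk : ∀ i j → i Fin.< j → Walk G (φ i) (path i j) (φ j)
    path-uniq : ∀ i j → i Fin.< j → Unique (path i j)
    path-avoid : ∀ i j → i Fin.< j → ∀ w → w ∈ˡ path i j → ∀ k → w ≢ φ k
    path-disj : ∀ i j i′ j′ → i Fin.< j → i′ Fin.< j′ → ¬ (i ≡ i′ × j ≡ j′) →
                ∀ w → w ∈ˡ path i j → w ∈ˡ path i′ j′ → ⊥

_⪯[_]_ : ℕ → ℕ → Graph → Set
t ⪯[ r ] G = KTopMinor t r G

IsDensenessFunction : ∀ {a b} {A : Set a} → (A → Set b) → (A → Graph) → (ℕ → ℕ) → Set (a ⊔ b)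
IsDensenessFunction P toG d = ∀ (r : ℕ) (x : _) → P x → ¬ (d r ⪯[ r ] toG x)

NowhereDense : ∀ {a b} {A : Set a} → (A → Set b) → (A → Graph) → Set (a ⊔ b)
NowhereDense P toG = Σ (ℕ → ℕ) (IsDensenessFunction P toG)

_∈ᵇ_ : ℕ → List ℕ → Bool
t ∈ᵇ xs = any (t ≡ᵇ_) xs

record TemporalGraph : Set where
  field
    footprint : StaticGraph
  open StaticGraph footprint public
  field
    lab          : Fin n → Fin n → List ℕ
    lab-sym      : ∀ u v → lab u v ≡ lab v u
    lab-nonedge  : ∀ u v → adj u v ≡ false → lab u v ≡ []
    lab-nonempty : ∀ u v → adj u v ≡ true → lab u v ≢ []
    lab-pos      : ∀ u v → All (1 ≤_) (lab u v)

module _ (𝒢 : TemporalGraph) where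
  open TemporalGraph 𝒢

  -- lifetime = largest label (0 if there are no temporal edges)
  lifetime : ℕ
  lifetime = foldr _⊔ℕ_ 0 (concatMap (λ u → concatMap (λ v → lab u v) (allFin n)) (allFin n))

  -- temporal edges (uv, t): the edge uv represented with u < v
  record TEdge : Set where
    constructor tedge
    field
      u v  : Fin n
      u<v  : u Fin.< v
      time : ℕ
      t∈λ  : T (time ∈ᵇ lab u v)

  TimeStep : Set
  TimeStep = Σ ℕ (λ t → 1 ≤ t × t ≤ lifetime)

  Universe : Set
  Universe = Fin n ⊎ (TEdge ⊎ TimeStep)

  IsV IsE IsL : Universe → Set
  IsV (inj₁ _)        = ⊤
  IsV (inj₂ _)        = ⊥
  IsE (inj₂ (inj₁ _)) = ⊤
  IsE _               = ⊥
  IsL (inj₂ (inj₂ _)) = ⊤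
  IsL _               = ⊥

  Inc : Universe → Universe → Set
  Inc (inj₂ (inj₁ e)) (inj₁ x) = x ≡ TEdge.u e ⊎ x ≡ TEdge.v e
  Inc _ _ = ⊥

  Pres : Universe → Universe → Set
  Pres (inj₂ (inj₁ e)) (inj₂ (inj₂ t′)) = proj₁ t′ ≡ TEdge.time e
  Pres _ _ = ⊥

  Less : Universe → Universe → Set
  Less (inj₂ (inj₂ s)) (inj₂ (inj₂ s′)) = proj₁ s < proj₁ s′
  Less _ _ = ⊥

record Structure : Set₁ where
  field
    U     : Set
    m     : ℕ
    arity : Fin m → ℕ
    rel   : (i : Fin m) → Vec U (arity i) → Set

Gaifman : Structure → Graph
Gaifman S = record
  { V = U
  ; _~_ = Adj
  ; ~-sym = λ { (a≢b , i , ar , xs , R , a∈ , b∈) → (λ e → a≢b (sym e)) , i , ar , xs , R , b∈ , a∈ }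
  ; ~-irr = λ { (a≢a , _) → a≢a refl }
  }
  where
  open Structure S
  Adj : U → U → Set
  Adj a b = a ≢ b × Σ (Fin m) λ i → 2 ≤ arity i × Σ (Vec U (arity i)) λ xs →
            rel i xs × a ∈ᵛ xs × b ∈ᵛ xs

-- The lifetime encoding S_Λ(𝒢): signature (V, 𝓔, L, inc, pres, <)
encArity : Fin 6 → ℕ
encArity zero                      = 1
encArity (suc zero)                = 1
encArity (suc (suc zero))          = 1
encArity (suc (suc (suc zero)))    = 2
encArity (suc (suc (suc (suc zero)))) = 2
encArity (suc (suc (suc (suc (suc zero))))) = 2

lifetimeEncoding : TemporalGraph → Structure
lifetimeEncoding 𝒢 = record { U = Universe 𝒢 ; m = 6 ; arity = encArity ; rel = R }
  where
  R : (i : Fin 6) → Vec (Universe 𝒢) (encArity i) → Set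
  R zero                                     (x ∷ [])     = IsV 𝒢 x
  R (suc zero)                               (x ∷ [])     = IsE 𝒢 x
  R (suc (suc zero))                         (x ∷ [])     = IsL 𝒢 x
  R (suc (suc (suc zero)))                   (x ∷ y ∷ []) = Inc 𝒢 x y
  R (suc (suc (suc (suc zero))))             (x ∷ y ∷ []) = Pres 𝒢 x y
  R (suc (suc (suc (suc (suc zero)))))       (x ∷ y ∷ []) = Less 𝒢 x y

InC′ : (StaticGraph → Set) → ℕ → TemporalGraph → Set
InC′ 𝒞 Λ 𝒢 = 𝒞 (TemporalGraph.footprint 𝒢) × lifetime 𝒢 ≤ Λ

⌈_/2⌉ : ℕ → ℕ
⌈ r /2⌉ = (r ℕ.+ 1) ℕ./ 2

-- Suppose K_t, t = d ⌈r/2⌉ + 2Λ, is a depth-r topological minor of the Gaifman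
-- graph of the lifetime encoding.  An element (uv, τ) of 𝓔 has only three
-- neighbours, u, v and τ, so if it is a branch vertex then t ≤ 4; since τ ≥ 1
-- forces Λ ≥ 1, this gives d ⌈r/2⌉ ≤ 2, and the footprint edge uv alone is then
-- a K_{d ⌈r/2⌉} minor.  Otherwise charge each branch vertex that is a time step,
-- or whose paths to later branch vertices meet a time step, to that time step:
-- disjointness of the model makes the charge injective, so at least d ⌈r/2⌉
-- branch vertices are uncharged.  Between those, paths alternate between
-- vertices and elements of 𝓔, and deleting the latter halves their length,
-- leaving a K_{d ⌈r/2⌉} of depth ⌈r/2⌉ in the footprint — a contradiction.

module Submission where

open import Defs
open import Data.Nat as ℕ using (ℕ; zero; suc; _+_; _*_; _≤_; z≤n; s≤s; _⊔_; _≡ᵇ_)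
open import Data.Nat.Properties as ℕ using ()
open import Data.Nat.DivMod using (m*n/n≡m; /-monoˡ-≤)
open import Data.Fin as Fin using (Fin; zero; suc; inject≤; fromℕ<; punchOut)
open import Data.Fin.Properties as Fin using (_≟_; <-cmp; injective⇒≤)
open import Data.Bool using (true; false; T)
open import Data.Unit using (⊤; tt)
open import Data.Empty using (⊥; ⊥-elim)
open import Data.Product using (Σ; ∃; _×_; _,_; proj₁; proj₂)
open import Data.Sum using (_⊎_; inj₁; inj₂)
open import Data.List using (List; []; _∷_; _∷ʳ_; length; foldr; concatMap; allFin)
open import Data.List.Relation.Unary.Any as Any using (Any; here; there)
open import Data.List.Relation.Unary.Any.Properties using (any⁻)
open import Data.List.Relation.Unary.All as All using (All; []; _∷_)
open import Data.List.Relation.Unary.All.Properties as All using ()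
open import Data.List.Relation.Unary.AllPairs using ([]; _∷_)
open import Data.List.Relation.Unary.Unique.Propositional using (Unique)
open import Data.List.Relation.Unary.Unique.Propositional.Properties as Unique using ()
open import Data.List.Membership.Propositional using (_∈_)
open import Data.List.Membership.Propositional.Properties using (∈-concatMap⁺; ∈-allFin)
open import Data.List.Membership.Setoid.Properties using (index-injective)
open import Data.Vec using ([]; _∷_)
open import Data.Vec.Relation.Unary.Any using (here; there)
open import Data.Vec.Membership.Propositional using () renaming (_∈_ to _∈ᵛ_)
open import Function using (_∘_)
open import Relation.Nullary using (¬_; Dec; yes; no; ¬?; _×-dec_)
open import Relation.Nullary.Decidable using (decidable-stable)
open import Relation.Unary using (Pred; Decidable)
open import Relation.Binary using (tri<; tri≈; tri>; _Preserves_⟶_)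
open import Relation.Binary.PropositionalEquality

increasing⇒injective : ∀ {s t} {σ : Fin s → Fin t} → σ Preserves Fin._<_ ⟶ Fin._<_ →
                       ∀ {i j} → σ i ≡ σ j → i ≡ j
increasing⇒injective mono {i} {j} eq with <-cmp i j
... | tri< i<j _ _ = ⊥-elim (Fin.<-irrefl eq (mono i<j))
... | tri≈ _ i≡j _ = i≡j
... | tri> _ _ j<i = ⊥-elim (Fin.<-irrefl (sym eq) (mono j<i))

IncreasingSelection : ∀ {ℓ} s {t} → Pred (Fin t) ℓ → Set ℓ
IncreasingSelection s {t} P =
  Σ (Fin s → Fin t) λ σ → σ Preserves Fin._<_ ⟶ Fin._<_ × (∀ i → P (σ i))

-- Scanning Fin t from the left: a good index is taken while more are needed,
-- a bad one uses up one of the m codes, which punchOut removes from the range.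
select : ∀ {ℓ} t s m {P : Pred (Fin t) ℓ} → Decidable P →
         (code : ∀ i → ¬ P i → Fin m) → (∀ {i j} p q → code i p ≡ code j q → i ≡ j) →
         s + m ≤ t → IncreasingSelection s P
select t       zero    m _ _ _ _ = (λ ()) , (λ { {()} }) , λ ()
select zero    (suc s) m _ _ _ ()
select (suc t) (suc s) m {P} P? code code-inj s+m≤t with P? zero
... | yes P0 = σ , σ-increasing , σ-good
  where
  rest : IncreasingSelection s (P ∘ suc)
  rest = select t s m (P? ∘ suc) (code ∘ suc)
                (λ p q → Fin.suc-injective ∘ code-inj p q) (ℕ.≤-pred s+m≤t)
  σ : Fin (suc s) → Fin (suc t)
  σ zero    = zero
  σ (suc i) = suc (proj₁ rest i)
  σ-increasing : σ Preserves Fin._<_ ⟶ Fin._<_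
  σ-increasing {zero}  {suc _} _         = s≤s z≤n
  σ-increasing {suc _} {suc _} (s≤s i<j) = s≤s (proj₁ (proj₂ rest) i<j)
  σ-good : ∀ i → P (σ i)
  σ-good zero    = P0
  σ-good (suc i) = proj₂ (proj₂ rest) i
... | no ¬P0 = skip code code-inj s+m≤t
  where
  skip : ∀ {m} (code : ∀ i → ¬ P i → Fin m) → (∀ {i j} p q → code i p ≡ code j q → i ≡ j) →
         suc s + m ≤ suc t → IncreasingSelection (suc s) P
  skip {zero}  code _        _      with code zero ¬P0
  ... | ()
  skip {suc m} code code-inj s+m≤t =
    (suc ∘ proj₁ rest) , (s≤s ∘ proj₁ (proj₂ rest)) , proj₂ (proj₂ rest)
    where
    c₀≢ : ∀ i q → code zero ¬P0 ≢ code (suc i) q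
    c₀≢ i q eq with code-inj ¬P0 q eq
    ... | ()
    rest : IncreasingSelection (suc s) (P ∘ suc)
    rest = select t (suc s) m (P? ∘ suc) (λ i q → punchOut (c₀≢ i q))
             (λ p q eq → Fin.suc-injective
                           (code-inj p q (Fin.punchOut-injective (c₀≢ _ p) (c₀≢ _ q) eq)))
             (ℕ.≤-pred (subst (_≤ suc t) (ℕ.+-suc (suc s) m) s+m≤t))

module _ (G : Graph) where
  open Graph G

  firstStep : ∀ {x y} ws → Walk G x ws y → Σ V λ w → x ~ w × (w ≡ y ⊎ w ∈ ws)
  firstStep []      x~y       = _ , x~y , inj₁ refl
  firstStep (w ∷ _) (x~w , _) = w , x~w , inj₂ (here refl)

  lastStep : ∀ {x y} ws → Walk G x ws y → Σ V λ w → w ~ y × (w ≡ x ⊎ w ∈ ws)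
  lastStep []       x~y        = _ , x~y , inj₁ refl
  lastStep (w ∷ ws) (_ , walk) with lastStep ws walk
  ... | w′ , w′~y , inj₁ refl = w′ , w′~y , inj₂ (here refl)
  ... | w′ , w′~y , inj₂ w′∈  = w′ , w′~y , inj₂ (there w′∈)

restrict : ∀ {G s t r} → t ⪯[ r ] G → (σ : Fin s → Fin t) → σ Preserves Fin._<_ ⟶ Fin._<_ →
           s ⪯[ r ] G
restrict M σ mono = record
  { φ          = φ ∘ σ
  ; φ-inj      = λ i j eq → σ-inj (φ-inj (σ i) (σ j) eq)
  ; path       = λ i j → path (σ i) (σ j)
  ; path-len   = λ i j i<j → path-len (σ i) (σ j) (mono i<j)
  ; path-walk  = λ i j i<j → path-walk (σ i) (σ j) (mono i<j)
  ; path-uniq  = λ i j i<j → path-uniq (σ i) (σ j) (mono i<j)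
  ; path-avoid = λ i j i<j w w∈ k → path-avoid (σ i) (σ j) (mono i<j) w w∈ (σ k)
  ; path-disj  = λ i j i′ j′ i<j i′<j′ pairs≢ →
      path-disj (σ i) (σ j) (σ i′) (σ j′) (mono i<j) (mono i′<j′) (λ (i≡ , j≡) → pairs≢ (σ-inj i≡ , σ-inj j≡))
  }
  where
  open KTopMinor M
  σ-inj : ∀ {i j} → σ i ≡ σ j → i ≡ j
  σ-inj = increasing⇒injective mono

edge⇒K₂-minor : ∀ {G r} {u v : Graph.V G} → Graph._~_ G u v → 2 ⪯[ r ] G
edge⇒K₂-minor {G} {u = u} {v} u~v = record
  { φ          = branch
  ; φ-inj      = branch-injective
  ; path       = λ _ _ → []
  ; path-len   = λ _ _ _ → z≤n
  ; path-walk  = walk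
  ; path-uniq  = λ _ _ _ → []
  ; path-avoid = λ _ _ _ _ ()
  ; path-disj  = λ _ _ _ _ _ _ _ _ ()
  }
  where
  open Graph G
  branch : Fin 2 → V
  branch zero    = u
  branch (suc _) = v
  u≢v : u ≢ v
  u≢v refl = ~-irr u~v
  branch-injective : ∀ i j → branch i ≡ branch j → i ≡ j
  branch-injective zero       zero       _  = refl
  branch-injective zero       (suc zero) eq = ⊥-elim (u≢v eq)
  branch-injective (suc zero) zero       eq = ⊥-elim (u≢v (sym eq))
  branch-injective (suc zero) (suc zero) _  = refl
  walk : ∀ i j → i Fin.< j → branch i ~ branch j
  walk zero       (suc zero) _ = u~v
  walk (suc zero) (suc zero) (s≤s ())

edge⇒small-clique-minor : ∀ {G s r} {u v : Graph.V G} → Graph._~_ G u v → s ≤ 2 → s ⪯[ r ] G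
edge⇒small-clique-minor u~v s≤2 =
  restrict (edge⇒K₂-minor u~v) (λ i → inject≤ i s≤2) inject≤-increasing
  where
  inject≤-increasing : ∀ {i j} → i Fin.< j → inject≤ i s≤2 Fin.< inject≤ j s≤2
  inject≤-increasing {i} {j} i<j =
    subst₂ ℕ._<_ (sym (Fin.toℕ-inject≤ i s≤2)) (sym (Fin.toℕ-inject≤ j s≤2)) i<j

module TopMinorProperties {G : Graph} {t r : ℕ} (M : t ⪯[ r ] G) where
  open Graph G
  open KTopMinor M

  OnPath : Fin t → Fin t → V → Set
  OnPath i j w = i Fin.< j × w ∈ path i j

  onPath-unique : ∀ {i j i′ j′ w} → OnPath i j w → OnPath i′ j′ w → i ≡ i′ × j ≡ j′
  onPath-unique {i} {j} {i′} {j′} (i<j , w∈) (i′<j′ , w∈′) with i ≟ i′ | j ≟ j′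
  ... | yes i≡i′ | yes j≡j′ = i≡i′ , j≡j′
  ... | no i≢i′  | _        = ⊥-elim (path-disj i j i′ j′ i<j i′<j′ (i≢i′ ∘ proj₁) _ w∈ w∈′)
  ... | _        | no j≢j′  = ⊥-elim (path-disj i j i′ j′ i<j i′<j′ (j≢j′ ∘ proj₂) _ w∈ w∈′)

  onPath-avoid : ∀ {i j w} → OnPath i j w → ∀ k → w ≢ φ k
  onPath-avoid (i<j , w∈) = path-avoid _ _ i<j _ w∈

  path-unique : ∀ {i j} → i Fin.< j → Unique (φ i ∷ path i j ∷ʳ φ j)
  path-unique {i} {j} i<j =
    All.++⁺ (All.tabulate λ w∈ φi≡w → path-avoid i j i<j _ w∈ i (sym φi≡w))
            ((λ φi≡φj → Fin.<-irrefl (φ-inj i j φi≡φj) i<j) ∷ [])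
    ∷ Unique.++⁺ (path-uniq i j i<j) ([] ∷ [])
                 (λ { (w∈ , here w≡φj) → path-avoid i j i<j _ w∈ j w≡φj })

  Owns : Fin t → V → Set
  Owns i w = w ≡ φ i ⊎ ∃ λ j → OnPath i j w

  owns-unique : ∀ {i i′ w} → Owns i w → Owns i′ w → i ≡ i′
  owns-unique (inj₁ w≡φi)     (inj₁ w≡φi′)     = φ-inj _ _ (trans (sym w≡φi) w≡φi′)
  owns-unique (inj₁ w≡φi)     (inj₂ (_ , p′)) = ⊥-elim (onPath-avoid p′ _ w≡φi)
  owns-unique (inj₂ (_ , p))  (inj₁ w≡φi′)     = ⊥-elim (onPath-avoid p _ w≡φi′)
  owns-unique (inj₂ (_ , p))  (inj₂ (_ , p′)) = proj₁ (onPath-unique p p′)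

  -- The possible first steps from φ i on the route to φ j.
  Towards : Fin t → Fin t → V → Set
  Towards i j w = w ≡ φ j ⊎ OnPath i j w ⊎ OnPath j i w

  neighbour-towards : ∀ {i j} → j ≢ i → Σ V λ w → φ i ~ w × Towards i j w
  neighbour-towards {i} {j} j≢i with <-cmp i j
  ... | tri≈ _ i≡j _ = ⊥-elim (j≢i (sym i≡j))
  ... | tri< i<j _ _ with firstStep G (path i j) (path-walk i j i<j)
  ...   | w , φi~w , inj₁ w≡φj = w , φi~w , inj₁ w≡φj
  ...   | w , φi~w , inj₂ w∈   = w , φi~w , inj₂ (inj₁ (i<j , w∈))
  neighbour-towards {i} {j} j≢i | tri> _ _ j<i with lastStep G (path j i) (path-walk j i j<i)
  ...   | w , w~φi , inj₁ w≡φj = w , ~-sym w~φi , inj₁ w≡φj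
  ...   | w , w~φi , inj₂ w∈   = w , ~-sym w~φi , inj₂ (inj₂ (j<i , w∈))

  towards-injective : ∀ {i j j′ w} → Towards i j w → Towards i j′ w → j ≡ j′
  towards-injective (inj₁ w≡φj) (inj₁ w≡φj′) = φ-inj _ _ (trans (sym w≡φj) w≡φj′)
  towards-injective (inj₁ w≡φj) (inj₂ (inj₁ p)) = ⊥-elim (onPath-avoid p _ w≡φj)
  towards-injective (inj₁ w≡φj) (inj₂ (inj₂ p)) = ⊥-elim (onPath-avoid p _ w≡φj)
  towards-injective (inj₂ (inj₁ p)) (inj₁ w≡φj′) = ⊥-elim (onPath-avoid p _ w≡φj′)
  towards-injective (inj₂ (inj₂ p)) (inj₁ w≡φj′) = ⊥-elim (onPath-avoid p _ w≡φj′)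
  towards-injective (inj₂ (inj₁ p)) (inj₂ (inj₁ p′)) = proj₂ (onPath-unique p p′)
  towards-injective (inj₂ (inj₂ p)) (inj₂ (inj₂ p′)) = proj₁ (onPath-unique p p′)
  towards-injective (inj₂ (inj₁ p@(i<j , _))) (inj₂ (inj₂ p′)) with onPath-unique p p′
  ... | refl , refl = ⊥-elim (Fin.<-irrefl refl i<j)
  towards-injective (inj₂ (inj₂ p@(j<i , _))) (inj₂ (inj₁ p′)) with onPath-unique p p′
  ... | refl , refl = ⊥-elim (Fin.<-irrefl refl j<i)

  -- The routes from φ i to the other t - 1 branch vertices leave φ i through
  -- pairwise distinct neighbours.
  branch-degree : ∀ i (ns : List V) → (∀ {w} → φ i ~ w → w ∈ ns) → t ≤ suc (length ns)
  branch-degree i ns covers = injective⇒≤ {f = λ j → slot j (j ≟ i)} (slot-injective _ _)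
    where
    slot : ∀ j → Dec (j ≡ i) → Fin (suc (length ns))
    slot j (yes _)   = zero
    slot j (no j≢i) = suc (Any.index (covers (proj₁ (proj₂ (neighbour-towards j≢i)))))
    slot-injective : ∀ {j j′} dj dj′ → slot j dj ≡ slot j′ dj′ → j ≡ j′
    slot-injective (yes refl) (yes refl) _ = refl
    slot-injective (no j≢i) (no j′≢i) eq
      with neighbour-towards j≢i | neighbour-towards j′≢i
         | index-injective (setoid _) (covers (proj₁ (proj₂ (neighbour-towards j≢i))))
                                      (covers (proj₁ (proj₂ (neighbour-towards j′≢i))))
                                      (Fin.suc-injective eq)
    ... | w , _ , to-j | .w , _ , to-j′ | refl = towards-injective to-j to-j′

∈ᵇ⇒∈ : ∀ {τ} xs → T (τ ∈ᵇ xs) → τ ∈ xs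
∈ᵇ⇒∈ {τ} xs = Any.map (λ {x} → ℕ.≡ᵇ⇒≡ τ x) ∘ any⁻ (τ ≡ᵇ_) xs

∈⇒≤foldr-⊔ : ∀ {x} xs → x ∈ xs → x ≤ foldr _⊔_ 0 xs
∈⇒≤foldr-⊔ (x ∷ xs) (here refl) = ℕ.m≤m⊔n x _
∈⇒≤foldr-⊔ (y ∷ xs) (there x∈) = ℕ.≤-trans (∈⇒≤foldr-⊔ xs x∈) (ℕ.m≤n⊔m y _)

orient-pair : ∀ {A : Set} {R : A → A → Set} {a b x y} → a ≢ b →
              a ∈ᵛ x ∷ y ∷ [] → b ∈ᵛ x ∷ y ∷ [] → R x y × R y x → R a b
orient-pair a≢b (here refl)         (here refl)         _ = ⊥-elim (a≢b refl)
orient-pair _   (here refl)         (there (here refl)) = proj₁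
orient-pair _   (there (here refl)) (here refl)         = proj₂
orient-pair a≢b (there (here refl)) (there (here refl)) _ = ⊥-elim (a≢b refl)

⌈/2⌉-bound : ∀ {m r} → suc (m * 2) ≤ r → m ≤ ⌈ r /2⌉
⌈/2⌉-bound {m} {r} le = subst (_≤ ⌈ r /2⌉) (m*n/n≡m m 2)
  (/-monoˡ-≤ 2 (ℕ.≤-trans (ℕ.n≤1+n _) (ℕ.≤-trans le (ℕ.m≤m+n r 1))))

pattern vert x = inj₁ x
pattern edge e = inj₂ (inj₁ e)
pattern step s = inj₂ (inj₂ s)

EncodingGraph : TemporalGraph → Graph
EncodingGraph 𝒢 = Gaifman (lifetimeEncoding 𝒢)

module TemporalGraphProperties (𝒢 : TemporalGraph) where
  open TemporalGraph 𝒢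
  open Graph (EncodingGraph 𝒢) using (_~_)
  open TEdge

  tedge-label : (e : TEdge 𝒢) → time e ∈ lab (u e) (v e)
  tedge-label e = ∈ᵇ⇒∈ (lab (u e) (v e)) (t∈λ e)

  tedge-timeStep : TEdge 𝒢 → TimeStep 𝒢
  tedge-timeStep e = time e , All.lookup (lab-pos (u e) (v e)) (tedge-label e) , time≤lifetime
    where
    time≤lifetime : time e ≤ lifetime 𝒢
    time≤lifetime = ∈⇒≤foldr-⊔ _ (∈-concatMap⁺ _ (Any.map (λ { refl → in-row }) (∈-allFin (u e))))
      where
      in-row : time e ∈ concatMap (lab (u e)) (allFin n)
      in-row = ∈-concatMap⁺ _ (Any.map (λ { refl → tedge-label e }) (∈-allFin (v e)))

  tedge-footprint : (e : TEdge 𝒢) → T (adj (u e) (v e))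
  tedge-footprint e with adj (u e) (v e) in uv-adj
  ... | true  = tt
  ... | false with () ← subst (time e ∈_) (lab-nonedge (u e) (v e) uv-adj) (tedge-label e)

  timeStep-≡ : ∀ {s s′ : TimeStep 𝒢} → proj₁ s ≡ proj₁ s′ → s ≡ s′
  timeStep-≡ {τ , 1≤τ , τ≤} {.τ , 1≤τ′ , τ≤′} refl =
    cong₂ (λ p q → τ , p , q) (ℕ.≤-irrelevant 1≤τ 1≤τ′) (ℕ.≤-irrelevant τ≤ τ≤′)

  Incident : TEdge 𝒢 → Fin n → Set
  Incident e x = x ≡ u e ⊎ x ≡ v e

  -- An over-approximation of adjacency in the Gaifman graph of the encoding,
  -- recording what each kind of neighbour must be.
  Linked : Universe 𝒢 → Universe 𝒢 → Set
  Linked (vert x) (edge e) = Incident e x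
  Linked (edge e) (vert x) = Incident e x
  Linked (edge e) (step s) = proj₁ s ≡ time e
  Linked (step s) (edge e) = proj₁ s ≡ time e
  Linked (step _) (step _) = ⊤
  Linked _        _        = ⊥

  inc⇒linked : ∀ {a b} → Inc 𝒢 a b → Linked a b × Linked b a
  inc⇒linked {edge _} {vert _} p = p , p
  inc⇒linked {vert _}          ()
  inc⇒linked {step _}          ()
  inc⇒linked {edge _} {edge _} ()
  inc⇒linked {edge _} {step _} ()

  pres⇒linked : ∀ {a b} → Pres 𝒢 a b → Linked a b × Linked b a
  pres⇒linked {edge _} {step _} p = p , p
  pres⇒linked {vert _}          ()
  pres⇒linked {step _}          ()
  pres⇒linked {edge _} {vert _} ()
  pres⇒linked {edge _} {edge _} ()

  less⇒linked : ∀ {a b} → Less 𝒢 a b → Linked a b × Linked b a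
  less⇒linked {step _} {step _} _ = tt , tt
  less⇒linked {vert _}          ()
  less⇒linked {edge _}          ()
  less⇒linked {step _} {vert _} ()
  less⇒linked {step _} {edge _} ()

  adjacent⇒linked : ∀ {a b} → a ~ b → Linked a b
  adjacent⇒linked (_ , zero ,             s≤s () , _)
  adjacent⇒linked (_ , suc zero ,         s≤s () , _)
  adjacent⇒linked (_ , suc (suc zero) ,   s≤s () , _)
  adjacent⇒linked (a≢b , suc (suc (suc zero)) , _ , _ ∷ _ ∷ [] , R , a∈ , b∈) =
    orient-pair a≢b a∈ b∈ (inc⇒linked R)
  adjacent⇒linked (a≢b , suc (suc (suc (suc zero))) , _ , _ ∷ _ ∷ [] , R , a∈ , b∈) =
    orient-pair a≢b a∈ b∈ (pres⇒linked R)
  adjacent⇒linked (a≢b , suc (suc (suc (suc (suc zero)))) , _ , _ ∷ _ ∷ [] , R , a∈ , b∈) =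
    orient-pair a≢b a∈ b∈ (less⇒linked R)

  incident⇒adjacent : ∀ e {x y} → Incident e x → Incident e y → x ≢ y → T (adj x y)
  incident⇒adjacent e (inj₁ refl) (inj₁ refl) x≢y = ⊥-elim (x≢y refl)
  incident⇒adjacent e (inj₁ refl) (inj₂ refl) _   = tedge-footprint e
  incident⇒adjacent e (inj₂ refl) (inj₁ refl) _   = subst T (adj-sym _ _) (tedge-footprint e)
  incident⇒adjacent e (inj₂ refl) (inj₂ refl) x≢y = ⊥-elim (x≢y refl)

  vertices : List (Universe 𝒢) → List (Fin n)
  vertices []            = []
  vertices (vert x ∷ ws) = x ∷ vertices ws
  vertices (inj₂ _ ∷ ws) = vertices ws

  vertices-∈ : ∀ {z} ws → z ∈ vertices ws → vert z ∈ ws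
  vertices-∈ (vert _ ∷ _)  (here refl) = here refl
  vertices-∈ (vert _ ∷ ws) (there z∈)  = there (vertices-∈ ws z∈)
  vertices-∈ (inj₂ _ ∷ ws) z∈          = there (vertices-∈ ws z∈)

  vertices-unique : ∀ ws → Unique ws → Unique (vertices ws)
  vertices-unique []            []                = []
  vertices-unique (vert x ∷ ws) (x∉ws ∷ ws-uniq) =
    All.tabulate (λ z∈ x≡z → All.lookup x∉ws (vertices-∈ ws z∈) (cong vert x≡z))
    ∷ vertices-unique ws ws-uniq
  vertices-unique (inj₂ _ ∷ ws) (_ ∷ ws-uniq)     = vertices-unique ws ws-uniq

  -- Without time steps the walk alternates between vertices and elements of 𝓔;
  -- distinctness rules out crossing an element of 𝓔 back to the vertex just left.
  project-walk : ∀ {x y} ws → ¬ Any (IsL 𝒢) ws → Walk (EncodingGraph 𝒢) (vert x) ws (vert y) →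
                 Unique (vert x ∷ ws ∷ʳ vert y) →
                 Walk (toGraph footprint) x (vertices ws) y × suc (length (vertices ws) * 2) ≡ length ws
  project-walk []                    _    x~y       _ = ⊥-elim (adjacent⇒linked x~y)
  project-walk (vert _ ∷ _)          _    (x~z , _) _ = ⊥-elim (adjacent⇒linked x~z)
  project-walk (step _ ∷ _)          no-L _         _ = ⊥-elim (no-L (here tt))
  project-walk (edge e ∷ [])         _    (x~e , e~y) ((_ ∷ x≢y ∷ []) ∷ _) =
    incident⇒adjacent e (adjacent⇒linked x~e) (adjacent⇒linked e~y) (x≢y ∘ cong vert) , refl
  project-walk (edge e ∷ vert z ∷ ws) no-L (x~e , e~z , walk) ((_ ∷ x≢z ∷ _) ∷ _ ∷ unique)
    with project-walk ws (λ L∈ws → no-L (there (there L∈ws))) walk unique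
  ... | walk′ , length≡ =
    (incident⇒adjacent e (adjacent⇒linked x~e) (adjacent⇒linked e~z) (x≢z ∘ cong vert) , walk′) ,
    cong (λ k → suc (suc k)) length≡
  project-walk (edge _ ∷ edge _ ∷ _) _    (_ , e~f , _) _ = ⊥-elim (adjacent⇒linked e~f)
  project-walk (edge _ ∷ step _ ∷ _) no-L _             _ = ⊥-elim (no-L (there (here tt)))

  project-minor : ∀ {s r} (M : s ⪯[ r ] EncodingGraph 𝒢) (φᵥ : Fin s → Fin n) →
            (∀ i → KTopMinor.φ M i ≡ vert (φᵥ i)) →
            (∀ i j → i Fin.< j → ¬ Any (IsL 𝒢) (KTopMinor.path M i j)) →
            s ⪯[ ⌈ r /2⌉ ] toGraph footprint
  project-minor {r = r} M φᵥ φ≡ no-L = record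
    { φ          = φᵥ
    ; φ-inj      = λ i j eq → φ-inj i j (trans (φ≡ i) (trans (cong vert eq) (sym (φ≡ j))))
    ; path       = λ i j → vertices (path i j)
    ; path-len   = λ i j i<j →
        ⌈/2⌉-bound (subst (_≤ r) (sym (proj₂ (projected i<j))) (path-len i j i<j))
    ; path-walk  = λ i j i<j → proj₁ (projected i<j)
    ; path-uniq  = λ i j i<j → vertices-unique _ (path-uniq i j i<j)
    ; path-avoid = λ i j i<j z z∈ k eq →
        path-avoid i j i<j (vert z) (vertices-∈ _ z∈) k (trans (cong vert eq) (sym (φ≡ k)))
    ; path-disj  = λ i j i′ j′ i<j i′<j′ pairs≢ z z∈ z∈′ →
        path-disj i j i′ j′ i<j i′<j′ pairs≢ (vert z) (vertices-∈ _ z∈) (vertices-∈ _ z∈′)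
    }
    where
    open KTopMinor M
    open TopMinorProperties M using (path-unique)
    projected : ∀ {i j} → i Fin.< j →
                Walk (toGraph footprint) (φᵥ i) (vertices (path i j)) (φᵥ j) ×
                suc (length (vertices (path i j)) * 2) ≡ length (path i j)
    projected {i} {j} i<j = project-walk (path i j) (no-L i j i<j)
      (subst₂ (λ a b → Walk (EncodingGraph 𝒢) a (path i j) b) (φ≡ i) (φ≡ j) (path-walk i j i<j))
      (subst₂ (λ a b → Unique (a ∷ path i j ∷ʳ b)) (φ≡ i) (φ≡ j) (path-unique i<j))

  edge-neighbours : ∀ e {w} → Linked (edge e) w →
                    w ∈ vert (u e) ∷ vert (v e) ∷ step (tedge-timeStep e) ∷ []
  edge-neighbours e {vert _} (inj₁ refl) = here refl
  edge-neighbours e {vert _} (inj₂ refl) = there (here refl)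
  edge-neighbours e {step _} τ≡time      = there (there (here (cong step (timeStep-≡ τ≡time))))

  tedge-branch⇒≤4 : ∀ {t r} (M : t ⪯[ r ] EncodingGraph 𝒢) {i e} → KTopMinor.φ M i ≡ edge e → t ≤ 4
  tedge-branch⇒≤4 M {i} {e} φi≡e =
    branch-degree i _ (λ φi~w → edge-neighbours e (adjacent⇒linked (subst (_~ _) φi≡e φi~w)))
    where open TopMinorProperties M

  -- Time steps are numbered from 1, hence the shift by one.
  timeIndex : ∀ {Λ} → lifetime 𝒢 ≤ Λ → TimeStep 𝒢 → Fin Λ
  timeIndex life≤Λ (suc τ , _ , τ<life) = fromℕ< (ℕ.≤-trans τ<life life≤Λ)

  timeIndex-injective : ∀ {Λ} (life≤Λ : lifetime 𝒢 ≤ Λ) {s s′} →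
                        timeIndex life≤Λ s ≡ timeIndex life≤Λ s′ → s ≡ s′
  timeIndex-injective _ {suc τ , _ , _} {suc τ′ , _ , _} eq =
    timeStep-≡ (cong suc (Fin.fromℕ<-injective τ τ′ _ _ eq))

  step-∈ : ∀ {ws} → Any (IsL 𝒢) ws → Σ (TimeStep 𝒢) λ s → step s ∈ ws
  step-∈ (here {x = step s} _) = s , here refl
  step-∈ (there L∈)           = proj₁ (step-∈ L∈) , there (proj₂ (step-∈ L∈))

  isL? : Decidable (IsL 𝒢)
  isL? (vert _) = no λ ()
  isL? (edge _) = no λ ()
  isL? (step _) = yes tt

  isVert? : ∀ (w : Universe 𝒢) → Dec (Σ (Fin n) λ x → w ≡ vert x)
  isVert? (vert x) = yes (x , refl)
  isVert? (inj₂ _) = no λ ()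

  tedge-free⇒footprint-minor : ∀ {s t r Λ} (M : t ⪯[ r ] EncodingGraph 𝒢) →
    (∀ i e → KTopMinor.φ M i ≢ edge e) → lifetime 𝒢 ≤ Λ → s + Λ ≤ t →
    s ⪯[ ⌈ r /2⌉ ] toGraph footprint
  tedge-free⇒footprint-minor {s} {t} {Λ = Λ} M no-edge life≤Λ s+Λ≤t =
    project-minor (restrict M σ σ-increasing) (proj₁ ∘ proj₁ ∘ good) (proj₂ ∘ proj₁ ∘ good)
            (λ i j i<j L∈ → proj₂ (good i) (σ j , σ-increasing i<j , L∈))
    where
    open KTopMinor M
    open TopMinorProperties M using (Owns; owns-unique)

    Crossing : Fin t → Set
    Crossing i = ∃ λ j → i Fin.< j × Any (IsL 𝒢) (path i j)

    crossing? : Decidable Crossing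
    crossing? i = Fin.any? (λ j → (i Fin.<? j) ×-dec Any.any? isL? (path i j))

    Good : Fin t → Set
    Good i = (Σ (Fin n) λ x → φ i ≡ vert x) × ¬ Crossing i

    good? : Decidable Good
    good? i = isVert? (φ i) ×-dec ¬? (crossing? i)

    charge : ∀ i → ¬ Good i → Σ (TimeStep 𝒢) λ s → Owns i (step s)
    charge i bad with φ i in φi≡
    ... | vert x with decidable-stable (crossing? i) (λ ¬crossing → bad ((x , refl) , ¬crossing))
    ...   | j , i<j , L∈ = proj₁ (step-∈ L∈) , inj₂ (j , i<j , proj₂ (step-∈ L∈))
    charge i bad | edge e = ⊥-elim (no-edge i e φi≡)
    charge i bad | step s = s , inj₁ refl

    code : ∀ i → ¬ Good i → Fin Λ
    code i bad = timeIndex life≤Λ (proj₁ (charge i bad))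

    code-injective : ∀ {i j} p q → code i p ≡ code j q → i ≡ j
    code-injective {i} {j} p q eq = owns-unique (proj₂ (charge i p))
      (subst (Owns j ∘ step) (sym (timeIndex-injective life≤Λ eq)) (proj₂ (charge j q)))

    selection : IncreasingSelection s Good
    selection = select t s Λ good? code code-injective s+Λ≤t

    σ : Fin s → Fin t
    σ = proj₁ selection

    σ-increasing : σ Preserves Fin._<_ ⟶ Fin._<_
    σ-increasing = proj₁ (proj₂ selection)

    good : ∀ i → Good (σ i)
    good = proj₂ (proj₂ selection)

  isEdge? : ∀ (w : Universe 𝒢) → Dec (Σ (TEdge 𝒢) λ e → w ≡ edge e)
  isEdge? (edge e) = yes (e , refl)
  isEdge? (vert _) = no λ ()
  isEdge? (step _) = no λ ()

  encoding-minor⇒footprint-minor : ∀ {k r Λ} → lifetime 𝒢 ≤ Λ →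
    (k + 2 * Λ) ⪯[ r ] EncodingGraph 𝒢 → k ⪯[ ⌈ r /2⌉ ] toGraph footprint
  encoding-minor⇒footprint-minor {k} {Λ = Λ} life≤Λ M with Fin.any? (isEdge? ∘ KTopMinor.φ M)
  ... | yes (i , e , φi≡e) = edge⇒small-clique-minor (tedge-footprint e) k≤2
    where
    1≤Λ : 1 ≤ Λ
    1≤Λ with tedge-timeStep e
    ... | _ , 1≤τ , τ≤life = ℕ.≤-trans 1≤τ (ℕ.≤-trans τ≤life life≤Λ)
    k≤2 : k ≤ 2
    k≤2 = ℕ.+-cancelʳ-≤ 2 k 2
      (ℕ.≤-trans (ℕ.+-monoʳ-≤ k (ℕ.*-monoʳ-≤ 2 1≤Λ)) (tedge-branch⇒≤4 M φi≡e))
  ... | no no-edge = tedge-free⇒footprint-minor M (λ i e φi≡e → no-edge (i , e , φi≡e)) life≤Λ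
                       (ℕ.+-monoʳ-≤ k (ℕ.m≤m+n Λ _))

open TemporalGraphProperties using (encoding-minor⇒footprint-minor)

mainTheorem5 : (𝒞 : StaticGraph → Set) (d : ℕ → ℕ) (Λ : ℕ) →
    IsDensenessFunction 𝒞 toGraph d →
    NowhereDense (InC′ 𝒞 Λ) (λ 𝒢 → Gaifman (lifetimeEncoding 𝒢))
    × IsDensenessFunction (InC′ 𝒞 Λ) (λ 𝒢 → Gaifman (lifetimeEncoding 𝒢)) (λ r → d ⌈ r /2⌉ + 2 * Λ)
mainTheorem5 𝒞 d Λ d-dense = (_ , dense) , dense
  where
  dense : IsDensenessFunction (InC′ 𝒞 Λ) EncodingGraph (λ r → d ⌈ r /2⌉ + 2 * Λ)
  dense r 𝒢 (footprint∈𝒞 , life≤Λ) =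
    d-dense ⌈ r /2⌉ (TemporalGraph.footprint 𝒢) footprint∈𝒞
    ∘ encoding-minor⇒footprint-minor 𝒢 life≤Λ
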